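{- Let $l>1$ be an integer and $n\in l\mathbb{Z}^+$, and write $n=b+al$ with $b\in l^2\mathbb{Z}^+$ and $0\leq a\leq l-1$ an integer (this representation is unique). Then $\|n\|_l=\|b\|_l+a$.
   Context: For a positive integer $l$ and $n\in l\mathbb{Z}^+$, the $l$-complexity $\|n\|_l$ is the minimal number of copies of $l$ needed to express $n$ from $l$ using only addition and multiplication (and parentheses). Equivalently, $\|l\|_l=1$ and $\|n\|_l=\min(\|a\|_l+\|b\|_l)$, the minimum over $a,b\in l\mathbb{Z}^+$ with $a+b=n$ or $ab=n$. -}

module Defs where

open import Data.Nat using (ℕ; _+_; _*_; _≤_)
open import Data.Product using (_×_)

data Expressible (l : ℕ) : ℕ → ℕ → Set where
  lit : Expressible l l 1
  add : ∀ {m n i j} → Expressible l m i → Expressible l n j → Expressible l (m + n) (i + j)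
  mul : ∀ {m n i j} → Expressible l m i → Expressible l n j → Expressible l (m * n) (i + j)

IsComplexity : ℕ → ℕ → ℕ → Set
IsComplexity l n k = Expressible l n k × (∀ j → Expressible l n j → k ≤ j)

{-# OPTIONS --safe #-}
module Submission where

open import Defs
open import Data.Nat using (ℕ; zero; suc; _+_; _*_; _^_; _<_; _≤_; _≤?_; _%_; z<s; NonZero; ≢-nonZero)
open import Data.Nat.Properties
open import Data.Nat.DivMod using ([m+kn]%n≡m%n; m<n⇒m%n≡m)
open import Data.Nat.Divisibility using (_∣_; divides; ∣-refl; ∣-trans; ∣m∣n⇒∣m+n; m∣m*n)
open import Data.Nat.Tactic.RingSolver using (solve-∀)
open import Data.Product using (_×_; _,_)
open import Relation.Nullary using (yes; no)
open import Relation.Binary.PropositionalEquality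
open import Algebra.Properties.CommutativeSemigroup +-commutativeSemigroup using (interchange)

-- Any expression of n can be rearranged
-- into an expression of its l²-part plus a loose copies of l, using no more copies:
-- products of multiples of l are multiples of l² and go to the l²-part, and in a
-- sum whose loose copies overflow past l, l of them (costing l ≥ 2) are traded for
-- one l * l (costing 2).  Since the split n = b + a l is unique, every expression
-- of n costs at least ‖b‖ + a, and adding a copies of l to an optimal expression
-- of b attains this.

m^2≡m*m : ∀ m → m ^ 2 ≡ m * m
m^2≡m*m m = cong (m *_) (*-identityʳ m)

remainder-unique : ∀ {m} .{{_ : NonZero m}} x y {r s} → r < m → s < m →
                   x * m + r ≡ y * m + s → r ≡ s
remainder-unique {m} x y {r} {s} r<m s<m eq = begin
  r               ≡⟨ m<n⇒m%n≡m r<m ⟨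
  r % m           ≡⟨ [m+kn]%n≡m%n r x m ⟨
  (r + x * m) % m ≡⟨ cong (_% m) (trans (+-comm r (x * m)) (trans eq (+-comm (y * m) s))) ⟩
  (s + y * m) % m ≡⟨ [m+kn]%n≡m%n s y m ⟩
  s % m           ≡⟨ m<n⇒m%n≡m s<m ⟩
  s               ∎
  where open ≡-Reasoning

digits-unique : ∀ {l a b} x y → a < l → b < l →
                x * (l * l) + a * l ≡ y * (l * l) + b * l → x ≡ y × a ≡ b
digits-unique {l} {a} {b} x y a<l b<l eq = x≡y , a≡b
  where
  instance
    l≢0 : NonZero l
    l≢0 = ≢-nonZero (m<n⇒n≢0 a<l)
    l*l≢0 : NonZero (l * l)
    l*l≢0 = m*n≢0 l l

  al≡bl : a * l ≡ b * l
  al≡bl = remainder-unique x y (*-monoˡ-< l a<l) (*-monoˡ-< l b<l) eq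

  a≡b : a ≡ b
  a≡b = *-cancelʳ-≡ a b l al≡bl

  x≡y : x ≡ y
  x≡y = *-cancelʳ-≡ x y (l * l)
          (+-cancelʳ-≡ (a * l) _ _ (trans eq (cong (y * (l * l) +_) (sym al≡bl))))

Expressible⇒∣ : ∀ {l n j} → Expressible l n j → l ∣ n
Expressible⇒∣ lit       = ∣-refl
Expressible⇒∣ (add E F) = ∣m∣n⇒∣m+n (Expressible⇒∣ E) (Expressible⇒∣ F)
Expressible⇒∣ (mul E F) = ∣-trans (Expressible⇒∣ E) (m∣m*n _)

add-copies : ∀ {l b k} → Expressible l b k → ∀ a → Expressible l (b + a * l) (k + a)
add-copies {l} {b} {k} E zero    =
  subst₂ (Expressible l) (sym (+-identityʳ b)) (sym (+-identityʳ k)) E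
add-copies {l} {b} {k} E (suc a) =
  subst₂ (Expressible l) (+-move b (a * l) l) (+-move k a 1) (add (add-copies E a) lit)
  where
  +-move : ∀ x y z → x + y + z ≡ x + (z + y)
  +-move = solve-∀

-- The l²-part of an expression may vanish; none is the empty expression of 0.
data Expressible₀ (l : ℕ) : ℕ → ℕ → Set where
  none : Expressible₀ l 0 0
  some : ∀ {n j} → Expressible l n j → Expressible₀ l n j

_+₀_ : ∀ {l m n i j} → Expressible₀ l m i → Expressible₀ l n j → Expressible₀ l (m + n) (i + j)
none   +₀ F      = F
some E +₀ none   = some (subst₂ (Expressible _) (sym (+-identityʳ _)) (sym (+-identityʳ _)) E)
some E +₀ some F = some (add E F)

Expressible₀⇒Expressible : ∀ {l n j} → Expressible₀ l n j → 0 < n → Expressible l n j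
Expressible₀⇒Expressible (some E) _ = E

record Decomposition (l n j : ℕ) : Set where
  constructor decomposition
  field
    high low cost : ℕ
    n≡high+low    : n ≡ high * (l * l) + low * l
    low<l         : low < l
    high-expr     : Expressible₀ l (high * (l * l)) cost
    cost+low≤j    : cost + low ≤ j

lit-decomposition : ∀ {l} → 1 < l → Decomposition l l 1
lit-decomposition 1<l = decomposition 0 1 0 (sym (+-identityʳ _)) 1<l none ≤-refl

mul-decomposition : ∀ {l m n i j} → 0 < l → Expressible l m i → Expressible l n j →
                    Decomposition l (m * n) (i + j)
mul-decomposition {l} {i = i} {j} 0<l E F with Expressible⇒∣ E | Expressible⇒∣ F
... | divides p refl | divides q refl =
  decomposition (p * q) 0 (i + j) (product p q l) 0<l
    (some (subst (λ n → Expressible l n (i + j)) (trans (product p q l) (+-identityʳ _)) (mul E F)))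
    (≤-reflexive (+-identityʳ (i + j)))
  where
  product : ∀ x y z → x * z * (y * z) ≡ x * y * (z * z) + 0 * z
  product = solve-∀

open Decomposition using (low)

regroup : ∀ h₁ a₁ h₂ a₂ l →
          h₁ * (l * l) + a₁ * l + (h₂ * (l * l) + a₂ * l) ≡ (h₁ + h₂) * (l * l) + (a₁ + a₂) * l
regroup = solve-∀

add-without-carry : ∀ {l m n i j} (D : Decomposition l m i) (E : Decomposition l n j) →
                    low D + low E < l → Decomposition l (m + n) (i + j)
add-without-carry {l} {i = i} {j} (decomposition h₁ a₁ c₁ refl _ X₁ c₁+a₁≤i)
                                  (decomposition h₂ a₂ c₂ refl _ X₂ c₂+a₂≤j) a₁+a₂<l =
  decomposition (h₁ + h₂) (a₁ + a₂) (c₁ + c₂) (regroup h₁ a₁ h₂ a₂ l) a₁+a₂<l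
    (subst (λ x → Expressible₀ l x (c₁ + c₂)) (sym (*-distribʳ-+ (l * l) h₁ h₂)) (X₁ +₀ X₂))
    (subst (_≤ i + j) (interchange c₁ a₁ c₂ a₂) (+-mono-≤ c₁+a₁≤i c₂+a₂≤j))

add-with-carry : ∀ {l m n i j a} (D : Decomposition l m i) (E : Decomposition l n j) →
                 2 ≤ l → l + a ≡ low D + low E → Decomposition l (m + n) (i + j)
add-with-carry {l} {i = i} {j} {a} (decomposition h₁ a₁ c₁ refl a₁<l X₁ c₁+a₁≤i)
                                   (decomposition h₂ a₂ c₂ refl a₂<l X₂ c₂+a₂≤j) 2≤l l+a≡a₁+a₂ =
  decomposition (h₁ + h₂ + 1) a (c₁ + c₂ + 2) sum≡ a<l
    (subst (λ x → Expressible₀ l x (c₁ + c₂ + 2)) (carry-high h₁ h₂ l)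
           ((X₁ +₀ X₂) +₀ some (mul lit lit)))
    cost≤
  where
  carry-high : ∀ x y z → x * (z * z) + y * (z * z) + z * z ≡ (x + y + 1) * (z * z)
  carry-high = solve-∀

  carry-low : ∀ x y a z → (x + y) * (z * z) + (z + a) * z ≡ (x + y + 1) * (z * z) + a * z
  carry-low = solve-∀

  a<l : a < l
  a<l = +-cancelˡ-< l a l (subst (_< l + l) (sym l+a≡a₁+a₂) (+-mono-< a₁<l a₂<l))

  sum≡ : h₁ * (l * l) + a₁ * l + (h₂ * (l * l) + a₂ * l) ≡ (h₁ + h₂ + 1) * (l * l) + a * l
  sum≡ = begin
    h₁ * (l * l) + a₁ * l + (h₂ * (l * l) + a₂ * l) ≡⟨ regroup h₁ a₁ h₂ a₂ l ⟩
    (h₁ + h₂) * (l * l) + (a₁ + a₂) * l             ≡⟨ cong (λ x → (h₁ + h₂) * (l * l) + x * l) l+a≡a₁+a₂ ⟨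
    (h₁ + h₂) * (l * l) + (l + a) * l               ≡⟨ carry-low h₁ h₂ a l ⟩
    (h₁ + h₂ + 1) * (l * l) + a * l                 ∎
    where open ≡-Reasoning

  cost≤ : c₁ + c₂ + 2 + a ≤ i + j
  cost≤ = begin
    c₁ + c₂ + 2 + a     ≤⟨ +-monoˡ-≤ a (+-monoʳ-≤ (c₁ + c₂) 2≤l) ⟩
    c₁ + c₂ + l + a     ≡⟨ +-assoc (c₁ + c₂) l a ⟩
    c₁ + c₂ + (l + a)   ≡⟨ cong (c₁ + c₂ +_) l+a≡a₁+a₂ ⟩
    c₁ + c₂ + (a₁ + a₂) ≡⟨ interchange c₁ c₂ a₁ a₂ ⟩
    c₁ + a₁ + (c₂ + a₂) ≤⟨ +-mono-≤ c₁+a₁≤i c₂+a₂≤j ⟩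
    i + j               ∎
    where open ≤-Reasoning

add-decomposition : ∀ {l m n i j} → 1 < l → Decomposition l m i → Decomposition l n j →
                    Decomposition l (m + n) (i + j)
add-decomposition {l} 1<l D E with l ≤? low D + low E
... | no  l≰a₁+a₂ = add-without-carry D E (≰⇒> l≰a₁+a₂)
... | yes l≤a₁+a₂ with m≤n⇒∃[o]m+o≡n l≤a₁+a₂
...   | _ , l+a≡a₁+a₂ = add-with-carry D E 1<l l+a≡a₁+a₂

decompose : ∀ {l n j} → 1 < l → Expressible l n j → Decomposition l n j
decompose 1<l lit       = lit-decomposition 1<l
decompose 1<l (add E F) = add-decomposition 1<l (decompose 1<l E) (decompose 1<l F)
decompose 1<l (mul E F) = mul-decomposition (<-trans z<s 1<l) E F

add-copies-optimal : ∀ {l b a k j} → 1 < l → l * l ∣ b → 0 < b → a < l →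
                     (∀ j → Expressible l b j → k ≤ j) → Expressible l (b + a * l) j → k + a ≤ j
add-copies-optimal {a = a} 1<l (divides d refl) 0<b a<l minimal E with decompose 1<l E
... | decomposition c a′ j′ b+al≡ a′<l X j′+a′≤j with digits-unique d c a<l a′<l b+al≡
...   | refl , refl = ≤-trans (+-monoˡ-≤ a (minimal j′ (Expressible₀⇒Expressible X 0<b))) j′+a′≤j

proposition2p5 : (l : ℕ) → 1 < l → (n b a : ℕ) → l ^ 2 ∣ b → 0 < b → a < l →
    n ≡ b + a * l → (k : ℕ) → IsComplexity l b k → IsComplexity l n (k + a)
proposition2p5 l 1<l n b a l^2∣b 0<b a<l refl k (E , minimal) =
  add-copies E a , λ j → add-copies-optimal 1<l l*l∣b 0<b a<l minimal
  where
  l*l∣b : l * l ∣ b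
  l*l∣b = subst (_∣ b) (m^2≡m*m l) l^2∣b
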